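{- Let $\Phi$ be an irreducible crystallographic root system of rank $\ell$ in the Euclidean space $E$ spanned by its simple system $\Delta$, with positive system $\Phi^+$. Let $V=E\oplus\mathbb{R}z$ with $z$ a unit vector orthogonal to $E$, identified with $V^*$; let $H_\alpha^j$ be the hyperplane of $V$ defined by $\alpha-jz$, $H_z$ the hyperplane defined by $z$, and $\mathcal{A}=\mathcal{A}(\Phi^+)=\{H_\alpha\mid\alpha\in\Phi^+\}$ the arrangement in $E$ of hyperplanes orthogonal to positive roots. Let $k\in\mathbb{Z}_{>0}$, let $I\subseteq\Phi^+$ be an ideal, and let $\mathcal{C}$ be either $\mathrm{Shi}^k_{+I}:=\{H_\alpha^{j}\mid \alpha\in\Phi^+,-k+1\le j\le k\}\cup\{H_z\}\cup\{H_\alpha^{ -k}\mid\alpha\in I\}$ or $\mathrm{Shi}^k_{ -I}:=(\{H_\alpha^{j}\mid \alpha\in\Phi^+,-k+1\le j\le k\}\cup\{H_z\})\setminus\{H_\alpha^{k}\mid\alpha\in I\}$. Let $X$ be an intersection of hyperplanes of $\mathcal{C}$ of codimension $3$ in $V$ with $X\subset H_z$, and choose a codimension-$2$ intersection $Y$ of hyperplanes of $\mathcal{A}$ with $X=Y\cap H_z$ (identifying $H_z$ with $E$). Let $\Psi:=\Phi\cap Y^\perp$ and $\Psi^+:=\Phi^+\cap Y^\perp$. Then $J:=I\cap\Psi^+$ is an ideal of $\Psi^+$, i.e. if $\alpha\in J$, $\beta\in\Psi^+$ and $\alpha-\beta\in\mathbb{Z}_{\ge0}\gamma_1+\mathbb{Z}_{\ge0}\gamma_2$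 where $\{\gamma_1,\gamma_2\}$ is the simple system of the rank-two root system $\Psi$ with respect to $\Psi^+$, then $\beta\in J$.
   Context: An ideal $I\subseteq\Phi^+$ is a subset such that whenever $\alpha\in I$, $\beta\in\Phi^+$ and $\alpha-\beta\in\sum_{\delta\in\Delta}\mathbb{Z}_{\ge0}\delta$, then $\beta\in I$. $\Psi$ is a (not necessarily irreducible) root system of rank two and $\Psi^+$ is a positive system of it. -}

module Defs where

open import Data.Nat using (ℕ)
open import Data.Integer using (ℤ; 0ℤ; 1ℤ; +_; _+_; _*_; -_; _-_; _≤_; _<_)
open import Data.Bool using (Bool)
open import Data.Empty using (⊥)
open import Data.Fin using (Fin)
open import Data.Vec using (Vec; []; _∷_; zipWith; map; replicate; tabulate)
open import Data.Vec.Relation.Unary.All using (All)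
open import Data.List using (List)
open import Data.List.Membership.Propositional using (_∈_)
open import Data.Product using (Σ; _×_; ∃; ∃-syntax)
open import Data.Sum using (_⊎_)
open import Relation.Binary.PropositionalEquality using (_≡_; _≢_)
open import Function.Bundles using (_⇔_)

-- Vectors of E, written in coordinates with respect to the simple
-- system Δ = {α₁,…,α_ℓ} (a basis of E).  Roots of a crystallographic
-- root system have integer coordinates in this basis.

Vecℤ : ℕ → Set
Vecℤ ℓ = Vec ℤ ℓ

infixl 6 _+ᵛ_ _-ᵛ_
infixl 7 _·ᵛ_

_+ᵛ_ : ∀ {ℓ} → Vecℤ ℓ → Vecℤ ℓ → Vecℤ ℓ
_+ᵛ_ = zipWith _+_

_-ᵛ_ : ∀ {ℓ} → Vecℤ ℓ → Vecℤ ℓ → Vecℤ ℓ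
_-ᵛ_ = zipWith _-_

_·ᵛ_ : ∀ {ℓ} → ℤ → Vecℤ ℓ → Vecℤ ℓ
c ·ᵛ v = map (c *_) v

0ᵛ : ∀ {ℓ} → Vecℤ ℓ
0ᵛ {ℓ} = replicate ℓ 0ℤ

basis : ∀ {ℓ} → Fin ℓ → Vecℤ ℓ
basis {ℓ} i = tabulate (λ j → δ i j)
  where
  open import Data.Fin using (_≟_)
  open import Relation.Nullary using (yes; no)
  δ : Fin ℓ → Fin ℓ → ℤ
  δ i j with i ≟ j
  ... | yes _ = 1ℤ
  ... | no _  = 0ℤ

dot : ∀ {n} → Vecℤ n → Vecℤ n → ℤ
dot [] [] = 0ℤ
dot (x ∷ xs) (y ∷ ys) = x * y + dot xs ys

form : ∀ {ℓ} → Vec (Vecℤ ℓ) ℓ → Vecℤ ℓ → Vecℤ ℓ → ℤ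
form G u v = dot u (map (λ row → dot row v) G)

Nonneg : ∀ {ℓ} → Vecℤ ℓ → Set
Nonneg v = All (0ℤ ≤_) v

Nonpos : ∀ {ℓ} → Vecℤ ℓ → Set
Nonpos v = All (_≤ 0ℤ) v

-- An irreducible crystallographic root system Φ of rank ℓ in
-- E = ℝ^ℓ (coordinates w.r.t. Δ), together with its simple system
-- Δ = standard basis and positive system Φ⁺ = Φ ∩ ℤ≥0 Δ.
-- The inner product of E is given by its (rescaled, integral,
-- symmetric, positive definite) Gram matrix G on Δ.

record RootSystem (ℓ : ℕ) : Set where
  field
    G        : Vec (Vecℤ ℓ) ℓ
    G-sym    : ∀ u v → form G u v ≡ form G v u
    G-posdef : ∀ v → v ≢ 0ᵛ → 0ℤ < form G v v
    roots    : List (Vecℤ ℓ)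
    zero∉Φ   : 0ᵛ ∈ roots → ⊥
    reduced  : ∀ α β → α ∈ roots → β ∈ roots →
               ∀ (p q : ℤ) → p ≢ 0ℤ → p ·ᵛ β ≡ q ·ᵛ α →
               β ≡ α ⊎ β ≡ (- 1ℤ) ·ᵛ α
    -- crystallographic + stable under reflections:
    -- ⟨β,α∨⟩ = 2(β,α)/(α,α) = c ∈ ℤ and s_α β = β - c α ∈ Φ
    reflect  : ∀ α β → α ∈ roots → β ∈ roots →
               Σ ℤ λ c → (c * form G α α ≡ (+ 2) * form G β α)
                         × (β -ᵛ c ·ᵛ α) ∈ roots
    -- Δ ⊆ Φ (so Φ spans E) and Δ is a simple system
    simple∈Φ : ∀ i → basis i ∈ roots
    signs    : ∀ α → α ∈ roots → Nonneg α ⊎ Nonpos α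
    irreducible : ∀ (f : Vecℤ ℓ → Bool) →
                  (∀ α β → α ∈ roots → β ∈ roots → f α ≢ f β →
                     form G α β ≡ 0ℤ) →
                  ∀ α β → α ∈ roots → β ∈ roots → f α ≡ f β

  _∈Φ : Vecℤ ℓ → Set
  α ∈Φ = α ∈ roots

  _∈Φ⁺ : Vecℤ ℓ → Set
  α ∈Φ⁺ = α ∈ roots × Nonneg α

open RootSystem public

IsIdeal : ∀ {ℓ} (Φ : RootSystem ℓ) → (Vecℤ ℓ → Set) → Set
IsIdeal Φ I =
  (∀ α → I α → _∈Φ⁺ Φ α) ×
  (∀ α β → I α → _∈Φ⁺ Φ β → Nonneg (α -ᵛ β) → I β)

LinIndep : ∀ {ℓ} → Vecℤ ℓ → Vecℤ ℓ → Set
LinIndep β₁ β₂ = ∀ (a b : ℤ) → a ·ᵛ β₁ +ᵛ b ·ᵛ β₂ ≡ 0ᵛ → a ≡ 0ℤ × b ≡ 0ℤ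

-- v ∈ ℝβ₁ + ℝβ₂  (for integral vectors, same as rational span)
InSpan : ∀ {ℓ} → Vecℤ ℓ → Vecℤ ℓ → Vecℤ ℓ → Set
InSpan β₁ β₂ v = ∃[ c ] ∃[ a ] ∃[ b ]
  (c ≢ 0ℤ × c ·ᵛ v ≡ a ·ᵛ β₁ +ᵛ b ·ᵛ β₂)

NonnegComb : ∀ {ℓ} → Vecℤ ℓ → Vecℤ ℓ → Vecℤ ℓ → Set
NonnegComb γ₁ γ₂ v = ∃[ c ] ∃[ a ] ∃[ b ]
  (0ℤ < c × 0ℤ ≤ a × 0ℤ ≤ b × c ·ᵛ v ≡ a ·ᵛ γ₁ +ᵛ b ·ᵛ γ₂)

NonposComb : ∀ {ℓ} → Vecℤ ℓ → Vecℤ ℓ → Vecℤ ℓ → Set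
NonposComb γ₁ γ₂ v = ∃[ c ] ∃[ a ] ∃[ b ]
  (0ℤ < c × a ≤ 0ℤ × b ≤ 0ℤ × c ·ᵛ v ≡ a ·ᵛ γ₁ +ᵛ b ·ᵛ γ₂)

-- Y = H_{β₁} ∩ H_{β₂} (β₁, β₂ ∈ Φ⁺ linearly independent) is a
-- codimension-2 flat of 𝒜(Φ⁺); Y^⊥ = span{β₁,β₂}.

Ψ : ∀ {ℓ} → RootSystem ℓ → Vecℤ ℓ → Vecℤ ℓ → Vecℤ ℓ → Set
Ψ Φ β₁ β₂ γ = _∈Φ Φ γ × InSpan β₁ β₂ γ

Ψ⁺ : ∀ {ℓ} → RootSystem ℓ → Vecℤ ℓ → Vecℤ ℓ → Vecℤ ℓ → Set
Ψ⁺ Φ β₁ β₂ γ = _∈Φ⁺ Φ γ × InSpan β₁ β₂ γ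

IsSimpleSystem2 : ∀ {ℓ} → (Vecℤ ℓ → Set) → (Vecℤ ℓ → Set) →
                  Vecℤ ℓ → Vecℤ ℓ → Set
IsSimpleSystem2 P P⁺ γ₁ γ₂ =
  P γ₁ × P γ₂ × LinIndep γ₁ γ₂ ×
  (∀ ψ → P ψ → NonnegComb γ₁ γ₂ ψ ⊎ NonposComb γ₁ γ₂ ψ) ×
  (∀ ψ → P ψ → (P⁺ ψ ⇔ NonnegComb γ₁ γ₂ ψ))

-- Ψ⁺ ⊆ Φ⁺, so the simple roots γ₁, γ₂ of Ψ⁺ lie in ℤ≥0 Δ, and hence so does every
-- element of ℤ≥0 γ₁ + ℤ≥0 γ₂.  A difference α − β of this shape is therefore
-- in ℤ≥0 Δ, and β ∈ I follows from I being an ideal of Φ⁺.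
module Submission where

open import Defs
open import Data.Nat using (ℕ)
open import Data.Integer using (+_; 0ℤ; 1ℤ; _+_; _*_; _≤_; +≤+; +<+)
open import Data.Integer.Properties using (+-identityʳ; +-identityˡ; +-mono-≤; *-monoˡ-≤-nonNeg; *-zeroʳ)
import Data.Nat as ℕ
open import Data.Product using (_×_; ∃-syntax; _,_; proj₁; proj₂)
open import Data.Vec using ([]; _∷_)
import Data.Vec.Relation.Unary.All as All
open import Data.Vec.Relation.Unary.All.Properties using (map⁺)
open import Relation.Binary.PropositionalEquality using (_≡_; refl; cong₂; sym; subst)
open import Function using (_∘_)
open import Function.Bundles using (Equivalence)

+ᵛ-0·ᵛ-identityʳ : ∀ {n} (u w : Vecℤ n) → 1ℤ ·ᵛ u ≡ 1ℤ ·ᵛ u +ᵛ 0ℤ ·ᵛ w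
+ᵛ-0·ᵛ-identityʳ []       []       = refl
+ᵛ-0·ᵛ-identityʳ (x ∷ u) (y ∷ w) = cong₂ _∷_ (sym (+-identityʳ (1ℤ * x))) (+ᵛ-0·ᵛ-identityʳ u w)

+ᵛ-0·ᵛ-identityˡ : ∀ {n} (u w : Vecℤ n) → 1ℤ ·ᵛ w ≡ 0ℤ ·ᵛ u +ᵛ 1ℤ ·ᵛ w
+ᵛ-0·ᵛ-identityˡ []       []       = refl
+ᵛ-0·ᵛ-identityˡ (x ∷ u) (y ∷ w) = cong₂ _∷_ (sym (+-identityˡ (1ℤ * y))) (+ᵛ-0·ᵛ-identityˡ u w)

NonnegComb-left : ∀ {n} (γ₁ γ₂ : Vecℤ n) → NonnegComb γ₁ γ₂ γ₁
NonnegComb-left γ₁ γ₂ =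
  1ℤ , 1ℤ , 0ℤ , +<+ (ℕ.s≤s ℕ.z≤n) , +≤+ ℕ.z≤n , +≤+ ℕ.z≤n , +ᵛ-0·ᵛ-identityʳ γ₁ γ₂

NonnegComb-right : ∀ {n} (γ₁ γ₂ : Vecℤ n) → NonnegComb γ₁ γ₂ γ₂
NonnegComb-right γ₁ γ₂ =
  1ℤ , 0ℤ , 1ℤ , +<+ (ℕ.s≤s ℕ.z≤n) , +≤+ ℕ.z≤n , +≤+ ℕ.z≤n , +ᵛ-0·ᵛ-identityˡ γ₁ γ₂

Nonneg-+ᵛ : ∀ {n} {u w : Vecℤ n} → Nonneg u → Nonneg w → Nonneg (u +ᵛ w)
Nonneg-+ᵛ = All.zipWith (+-mono-≤ {0ℤ} {_} {0ℤ})

Nonneg-+·ᵛ : ∀ {n} (a : ℕ) {u : Vecℤ n} → Nonneg u → Nonneg ((+ a) ·ᵛ u)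
Nonneg-+·ᵛ a = map⁺ ∘ All.map scale
  where
  scale : ∀ {x} → 0ℤ ≤ x → 0ℤ ≤ (+ a) * x
  scale {x} 0≤x = subst (_≤ (+ a) * x) (*-zeroʳ (+ a)) (*-monoˡ-≤-nonNeg (+ a) 0≤x)

Nonneg-nonnegComb : ∀ {n} (a b : ℕ) {u w : Vecℤ n} → Nonneg u → Nonneg w →
                    Nonneg ((+ a) ·ᵛ u +ᵛ (+ b) ·ᵛ w)
Nonneg-nonnegComb a b u≥0 w≥0 = Nonneg-+ᵛ (Nonneg-+·ᵛ a u≥0) (Nonneg-+·ᵛ b w≥0)

simpleRoots-Nonneg : ∀ {ℓ} (Φ : RootSystem ℓ) {β₁ β₂ γ₁ γ₂ : Vecℤ ℓ} →
                     IsSimpleSystem2 (Ψ Φ β₁ β₂) (Ψ⁺ Φ β₁ β₂) γ₁ γ₂ →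
                     Nonneg γ₁ × Nonneg γ₂
simpleRoots-Nonneg Φ {β₁} {β₂} {γ₁} {γ₂} (Ψγ₁ , Ψγ₂ , _ , _ , Ψ⁺⇔NonnegComb) =
  positive Ψγ₁ (NonnegComb-left γ₁ γ₂) , positive Ψγ₂ (NonnegComb-right γ₁ γ₂)
  where
  positive : ∀ {γ} → Ψ Φ β₁ β₂ γ → NonnegComb γ₁ γ₂ γ → Nonneg γ
  positive {γ} Ψγ = proj₂ ∘ proj₁ ∘ Equivalence.from (Ψ⁺⇔NonnegComb γ Ψγ)

lemma4p1 : ∀ {ℓ} (Φ : RootSystem ℓ) (I : Vecℤ ℓ → Set) → IsIdeal Φ I →
    ∀ (β₁ β₂ : Vecℤ ℓ) → _∈Φ⁺ Φ β₁ → _∈Φ⁺ Φ β₂ → LinIndep β₁ β₂ →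
    ∀ (γ₁ γ₂ : Vecℤ ℓ) →
    IsSimpleSystem2 (Ψ Φ β₁ β₂) (Ψ⁺ Φ β₁ β₂) γ₁ γ₂ →
    ∀ α β → (I α × Ψ⁺ Φ β₁ β₂ α) → Ψ⁺ Φ β₁ β₂ β →
    (∃[ a ] ∃[ b ] (α -ᵛ β ≡ (+ a) ·ᵛ γ₁ +ᵛ (+ b) ·ᵛ γ₂)) →
    I β × Ψ⁺ Φ β₁ β₂ β
lemma4p1 Φ I (_ , downClosed) β₁ β₂ _ _ _ γ₁ γ₂ simple α β (Iα , _) Ψ⁺β (a , b , α-β≡) =
  downClosed α β Iα (proj₁ Ψ⁺β) α-β≥0 , Ψ⁺β
  where
  α-β≥0 : Nonneg (α -ᵛ β)
  α-β≥0 = let (γ₁≥0 , γ₂≥0) = simpleRoots-Nonneg Φ simple in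
          subst Nonneg (sym α-β≡) (Nonneg-nonnegComb a b γ₁≥0 γ₂≥0)
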